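{- Let $y,y'$ be weakly increasing compositions and $z,z'$ be weakly decreasing compositions such that $yz$ is a rearrangement of $y'z'$. Then for any $u,v\in\mathbb{P}^*$ with $u\sim_s v$ we have $y\,u^{+m}\,z\sim_s y'\,v^{+m}\,z'$ whenever $m\ge\max\{y,z\}-1$, where $\max\{y,z\}$ is the largest letter occurring in $y$ or $z$.
   Context: $\mathbb{P}$ is the positive integers; compositions are finite words in $\mathbb{P}^*$; juxtaposition is concatenation. Generalized factor order: $u\le w$ iff there is a factor $w'$ of $w$ (consecutive letters) with $|w'|=|u|$ and $u_i\le w'_i$ for all $i$; if $w'$ starts at the $j$th letter of $w$, $j$ is an embedding index, and $\mathrm{Em}(u,w)$ is the set of these. The weight of $w=w_1\cdots w_\ell$ is $t^\ell x^{w_1+\cdots+w_\ell}$. $u\sim_s v$ (strong Wilf equivalence) means there is a weight-preserving bijection $f:\mathbb{P}^*\to\mathbb{P}^*$ with $\mathrm{Em}(u,w)=\mathrm{Em}(v,f(w))$ for all $w$. $u^{+m}$ adds $m$ to every letter of $u$. -}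

module Defs where

open import Data.Nat using (ℕ; zero; suc; _+_; _≤_; _⊔_; z≤n; s≤s)
open import Data.Nat.Properties using (≤-trans; m≤n+m)
open import Data.List using (List; []; _∷_; _++_; length; drop; take; foldr; map)
open import Data.List.Relation.Binary.Pointwise using (Pointwise)
open import Data.List.Relation.Unary.Linked using (Linked)
open import Data.Product using (Σ; _×_; _,_; proj₁)
open import Function.Bundles using (_⤖_; _⇔_; Bijection)
open import Relation.Binary.PropositionalEquality using (_≡_)
open import Data.Empty using (⊥)

record ℙ : Set where
  constructor pos
  field
    val  : ℕ
    val≥1 : 1 ≤ val
open ℙ public

Comp : Set
Comp = List ℙ

_≤ₚ_ : ℙ → ℙ → Set
a ≤ₚ b = val a ≤ val b

-- sum of letters and weight t^ℓ x^{sum}, recorded as the pair (ℓ , sum)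
∣_∣ₓ : Comp → ℕ
∣ w ∣ₓ = foldr (λ a s → val a + s) 0 w

weight : Comp → ℕ × ℕ
weight w = length w , ∣ w ∣ₓ

Em : Comp → Comp → ℕ → Set
Em u w zero    = ⊥  -- indices are 1-based; 0 is never an embedding index
Em u w (suc j) = (length u + j ≤ length w) × Pointwise _≤ₚ_ u (take (length u) (drop j w))

_∼ₛ_ : Comp → Comp → Set
u ∼ₛ v = Σ (Comp ⤖ Comp) λ f →
           (∀ w → weight (Bijection.to f w) ≡ weight w)
         × (∀ w j → Em u w j ⇔ Em v (Bijection.to f w) j)

shift : ℕ → ℙ → ℙ
shift m (pos n p) = pos (m + n) (≤-trans p (m≤n+m n m))

_⁺_ : Comp → ℕ → Comp
u ⁺ m = map (shift m) u

WeaklyIncreasing : Comp → Set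
WeaklyIncreasing = Linked _≤ₚ_

WeaklyDecreasing : Comp → Set
WeaklyDecreasing = Linked (λ a b → b ≤ₚ a)

-- largest letter of a composition (0 for the empty word)
maxLetter : Comp → ℕ
maxLetter = foldr (λ a s → val a ⊔ s) 0

-- Three operations preserve strong Wilf equivalence: prepending a 1 (keep the bijection),
-- adding k to every letter (lower each maximal run of letters > k of the text by k, apply
-- the bijection to it and raise it back), and 1u ∼ₛ u1 (rotate the text by one letter).
-- If yz contains a 1, monotonicity puts it at the front of y or at the back of z, and
-- likewise for y′z′; rotating both 1s to the front and cancelling them shortens yz.  If
-- every letter of yz is at least 2, then y, z, y′, z′ and m can all be lowered by one and
-- the resulting equivalence shifted back up by 1.  The bound on the letters of yz
-- guarantees that this ends with yz empty, where the claim is u⁺ᵐ ∼ₛ v⁺ᵐ.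

module Submission where

open import Defs
open import Data.Empty using (⊥; ⊥-elim)
open import Data.List using (List; []; _∷_; _++_; [_]; _∷ʳ_; length; drop; take; map; initLast; _∷ʳ′_)
open import Data.List.Properties
  using (length-++; length-map; length-drop; drop-[]; drop-all; drop-map; map-++; map-∘; map-cong; map-id; map-id-local;
         ++-assoc; ++-identityʳ; ∷ʳ-injective)
open import Data.List.Relation.Binary.Permutation.Propositional using (_↭_; ↭-refl; ↭-sym; ↭-trans; ↭-reflexive)
open import Data.List.Relation.Binary.Permutation.Propositional.Properties as ↭
  using (drop-∷; All-resp-↭; ¬x∷xs↭[]; ↭-length; ∷↭∷ʳ)
open import Data.List.Relation.Binary.Pointwise using (Pointwise; []; _∷_)
open import Data.List.Relation.Unary.All as All using (All; []; _∷_)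
open import Data.List.Relation.Unary.All.Properties as All using (++⁺; ++⁻ˡ; ++⁻ʳ)
open import Data.List.Relation.Unary.Linked as Linked using (Linked; []; [-]; _∷_)
open import Data.List.Relation.Unary.Linked.Properties as Linked using (Linked⇒All)
open import Data.Nat using (ℕ; zero; suc; _+_; _*_; _∸_; _≤_; _<_; z≤n; s≤s; s≤s⁻¹; _≤?_; _<?_)
open import Data.Nat.Properties
open import Data.Product using (Σ; _×_; _,_; proj₁; proj₂; map₂; uncurry)
open import Data.Product.Function.NonDependent.Propositional using (_×-⇔_)
open import Data.Sum using (_⊎_; inj₁; inj₂)
open import Data.Unit using (⊤; tt)
open import Function.Base using (_∘_)
open import Function.Bundles using (_⇔_; mk⇔; mk↔ₛ′; Equivalence; Inverse)
open import Function.Construct.Composition using (_⇔-∘_)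
open import Function.Construct.Identity using (⇔-id)
open import Function.Construct.Symmetry using (⇔-sym)
open import Function.Properties.Bijection using (⤖⇒↔)
open import Function.Properties.Inverse using (↔⇒⤖)
open import Relation.Nullary using (yes; no; ¬_)
open import Relation.Binary.PropositionalEquality
  using (_≡_; refl; sym; trans; cong; cong₂; subst; subst₂; module ≡-Reasoning)
open import Algebra.Properties.CommutativeSemigroup +-commutativeSemigroup using (interchange)

one : ℙ
one = pos 1 (s≤s z≤n)

ℙ-≡ : ∀ {a b : ℙ} → val a ≡ val b → a ≡ b
ℙ-≡ {pos n p} {pos .n q} refl = cong (pos n) (≤-irrelevant p q)

≤1⇒≡one : ∀ x → val x ≤ 1 → x ≡ one
≤1⇒≡one (pos (suc zero) _) _ = ℙ-≡ refl
≤1⇒≡one (pos (suc (suc _)) _) (s≤s ())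

Large : ℙ → Set
Large x = 2 ≤ val x

one-not-large : ¬ Large one
one-not-large (s≤s ())

≤ₚ-large : ∀ {a b} → Large a → a ≤ₚ b → Large b
≤ₚ-large = ≤-trans

drop-beyond : ∀ j (w : Comp) → ¬ j ≤ length w → drop j w ≡ []
drop-beyond j w j≰ = drop-all j w (<⇒≤ (≰⇒> j≰))

drop-++-≤ : ∀ j (a b : Comp) → j ≤ length a → drop j (a ++ b) ≡ drop j a ++ b
drop-++-≤ zero    a       b _       = refl
drop-++-≤ (suc j) (x ∷ a) b (s≤s l) = drop-++-≤ j a b l

drop-++-∷ : ∀ j (a : Comp) x b → length a < j → drop j (a ++ x ∷ b) ≡ drop (j ∸ suc (length a)) b
drop-++-∷ (suc j) []      x b _       = refl
drop-++-∷ (suc j) (y ∷ a) x b (s≤s l) = drop-++-∷ j a x b l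

∣++∣ₓ : ∀ a b → ∣ a ++ b ∣ₓ ≡ ∣ a ∣ₓ + ∣ b ∣ₓ
∣++∣ₓ []      b = refl
∣++∣ₓ (x ∷ a) b = trans (cong (val x +_) (∣++∣ₓ a b)) (sym (+-assoc (val x) _ _))

weight-++ : ∀ a b → weight (a ++ b) ≡ (length a + length b , ∣ a ∣ₓ + ∣ b ∣ₓ)
weight-++ a b = cong₂ _,_ (length-++ a) (∣++∣ₓ a b)

weight-++-comm : ∀ a b → weight (a ++ b) ≡ weight (b ++ a)
weight-++-comm a b = trans (weight-++ a b)
  (trans (cong₂ _,_ (+-comm (length a) _) (+-comm ∣ a ∣ₓ _)) (sym (weight-++ b a)))

weight-++-cong : ∀ a a′ b b′ → weight a ≡ weight a′ → weight b ≡ weight b′ → weight (a ++ b) ≡ weight (a′ ++ b′)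
weight-++-cong a a′ b b′ ea eb =
  trans (weight-++ a b) (trans (cong₂ (λ (l , n) (l′ , n′) → l + l′ , n + n′) ea eb) (sym (weight-++ a′ b′)))

weight-∷-cong : ∀ x w w′ → weight w ≡ weight w′ → weight (x ∷ w) ≡ weight (x ∷ w′)
weight-∷-cong x w w′ e = cong (λ (l , n) → suc l , val x + n) e

∣⁺∣ₓ : ∀ k r → ∣ r ⁺ k ∣ₓ ≡ length r * k + ∣ r ∣ₓ
∣⁺∣ₓ k []            = refl
∣⁺∣ₓ k (pos n _ ∷ r) = trans (cong ((k + n) +_) (∣⁺∣ₓ k r)) (interchange k n _ _)

weight-⁺ : ∀ k r → weight (r ⁺ k) ≡ (length r , length r * k + ∣ r ∣ₓ)
weight-⁺ k r = cong₂ _,_ (length-map (shift k) r) (∣⁺∣ₓ k r)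

weight-⁺-cong : ∀ k r r′ → weight r ≡ weight r′ → weight (r ⁺ k) ≡ weight (r′ ⁺ k)
weight-⁺-cong k r r′ e =
  trans (weight-⁺ k r) (trans (cong (λ (l , n) → l , l * k + n) e) (sym (weight-⁺ k r′)))

⁺-⁺ : ∀ u k m → (u ⁺ m) ⁺ k ≡ u ⁺ (k + m)
⁺-⁺ u k m = trans (sym (map-∘ u)) (map-cong (λ (pos n _) → ℙ-≡ (sym (+-assoc k m n))) u)

infix 4 _⊑_ _≈ₛ_

_⊑_ : Comp → Comp → Set
[]      ⊑ _       = ⊤
(_ ∷ _) ⊑ []      = ⊥
(p ∷ P) ⊑ (x ∷ t) = p ≤ₚ x × P ⊑ t

-- 0-based: Occurs P w j corresponds to Em P w (suc j) without its range condition j ≤ |w|.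
Occurs : Comp → Comp → ℕ → Set
Occurs P w j = P ⊑ drop j w

⊑-refl : ∀ P → P ⊑ P
⊑-refl []      = tt
⊑-refl (p ∷ P) = ≤-refl , ⊑-refl P

⊑⇒length≤ : ∀ P t → P ⊑ t → length P ≤ length t
⊑⇒length≤ []      _       _       = z≤n
⊑⇒length≤ (p ∷ P) (x ∷ t) (_ , d) = s≤s (⊑⇒length≤ P t d)

⊑⇒Pointwise-take : ∀ P t → P ⊑ t → Pointwise _≤ₚ_ P (take (length P) t)
⊑⇒Pointwise-take []      _       _       = []
⊑⇒Pointwise-take (p ∷ P) (x ∷ t) (a , d) = a ∷ ⊑⇒Pointwise-take P t d

Pointwise-take⇒⊑ : ∀ P t → length P ≤ length t → Pointwise _≤ₚ_ P (take (length P) t) → P ⊑ t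
Pointwise-take⇒⊑ []      _       _       _       = tt
Pointwise-take⇒⊑ (p ∷ P) (x ∷ t) (s≤s l) (a ∷ r) = a , Pointwise-take⇒⊑ P t l r

⊑[]-resp-length : ∀ P Q → length P ≡ length Q → P ⊑ [] → Q ⊑ []
⊑[]-resp-length []      []      _  _ = tt
⊑[]-resp-length []      (_ ∷ _) () _
⊑[]-resp-length (_ ∷ _) _       _  ()

Em-suc⇔ : ∀ P w j → Em P w (suc j) ⇔ (j ≤ length w × Occurs P w j)
Em-suc⇔ P w j = mk⇔
  (λ (l , pw) → m+n≤o⇒n≤o (length P) l
              , Pointwise-take⇒⊑ P (drop j w)
                  (subst (length P ≤_) (sym (length-drop j w)) (m+n≤o⇒m≤o∸n (length P) l)) pw)
  (λ (j≤ , d) → m≤o∸n⇒m+n≤o (length P) j≤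
                  (subst (length P ≤_) (length-drop j w) (⊑⇒length≤ P (drop j w) d))
              , ⊑⇒Pointwise-take P (drop j w) d)

Em-suc⇔Occurs : ∀ P w j → j ≤ length w → Em P w (suc j) ⇔ Occurs P w j
Em-suc⇔Occurs P w j j≤ = mk⇔ (proj₂ ∘ Equivalence.to (Em-suc⇔ P w j)) (Equivalence.from (Em-suc⇔ P w j) ∘ (j≤ ,_))

Em-self : ∀ P → Em P P 1
Em-self P = Equivalence.from (Em-suc⇔Occurs P P 0 z≤n) (⊑-refl P)

Em-one⇒length≤ : ∀ P w → Em P w 1 → length P ≤ length w
Em-one⇒length≤ P w e = ⊑⇒length≤ P w (proj₂ (Equivalence.to (Em-suc⇔ P w 0) e))

record _≈ₛ_ (P Q : Comp) : Set where
  field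
    length-≡  : length P ≡ length Q
    to from   : Comp → Comp
    to-from   : ∀ w → to (from w) ≡ w
    from-to   : ∀ w → from (to w) ≡ w
    weight-to : ∀ w → weight (to w) ≡ weight w
    occurs-to : ∀ w j → Occurs P w j ⇔ Occurs Q (to w) j

  length-to : ∀ w → length (to w) ≡ length w
  length-to w = cong proj₁ (weight-to w)

≈ₛ-refl : ∀ {P} → P ≈ₛ P
≈ₛ-refl = record
  { length-≡ = refl ; to = λ w → w ; from = λ w → w ; to-from = λ _ → refl ; from-to = λ _ → refl
  ; weight-to = λ _ → refl ; occurs-to = λ _ _ → mk⇔ (λ d → d) (λ d → d) }

≈ₛ-sym : ∀ {P Q} → P ≈ₛ Q → Q ≈ₛ P
≈ₛ-sym {P} {Q} s = record
  { length-≡ = sym length-≡ ; to = from ; from = to ; to-from = from-to ; from-to = to-from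
  ; weight-to = λ w → trans (sym (weight-to (from w))) (cong weight (to-from w))
  ; occurs-to = λ w j → ⇔-sym (subst (λ x → Occurs P (from w) j ⇔ Occurs Q x j) (to-from w)
                                     (occurs-to (from w) j)) }
  where open _≈ₛ_ s

≈ₛ-trans : ∀ {P Q R} → P ≈ₛ Q → Q ≈ₛ R → P ≈ₛ R
≈ₛ-trans s t = record
  { length-≡ = trans S.length-≡ T.length-≡
  ; to = λ w → T.to (S.to w) ; from = λ w → S.from (T.from w)
  ; to-from = λ w → trans (cong T.to (S.to-from (T.from w))) (T.to-from w)
  ; from-to = λ w → trans (cong S.from (T.from-to (S.to w))) (S.from-to w)
  ; weight-to = λ w → trans (T.weight-to (S.to w)) (S.weight-to w)
  ; occurs-to = λ w j → T.occurs-to (S.to w) j ⇔-∘ S.occurs-to w j }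
  where module S = _≈ₛ_ s; module T = _≈ₛ_ t

≈ₛ⇒∼ₛ : ∀ {P Q} → P ≈ₛ Q → P ∼ₛ Q
≈ₛ⇒∼ₛ {P} {Q} s = ↔⇒⤖ (mk↔ₛ′ to from to-from from-to) , weight-to , em
  where
  open _≈ₛ_ s
  em : ∀ w j → Em P w j ⇔ Em Q (to w) j
  em w zero    = mk⇔ (λ ()) (λ ())
  em w (suc j) = ⇔-sym (Em-suc⇔ Q (to w) j)
             ⇔-∘ ((mk⇔ (subst (j ≤_) (sym (length-to w))) (subst (j ≤_) (length-to w)) ×-⇔ occurs-to w j)
             ⇔-∘ Em-suc⇔ P w j)

∼ₛ⇒≈ₛ : ∀ {P Q} → P ∼ₛ Q → P ≈ₛ Q
∼ₛ⇒≈ₛ {P} {Q} (f , weight-to , em) = record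
  { length-≡ = length-≡ ; to = to ; from = from ; to-from = strictlyInverseˡ ; from-to = strictlyInverseʳ
  ; weight-to = weight-to ; occurs-to = occurs-to }
  where
  open Inverse (⤖⇒↔ f) using (to; from; strictlyInverseˡ; strictlyInverseʳ)

  length-to : ∀ w → length (to w) ≡ length w
  length-to w = cong proj₁ (weight-to w)

  length-≡ : length P ≡ length Q
  length-≡ = ≤-antisym
    (subst (length P ≤_) (trans (sym (length-to (from Q))) (cong length (strictlyInverseˡ Q)))
      (Em-one⇒length≤ P (from Q) (Equivalence.from (em (from Q) 1)
        (subst (λ x → Em Q x 1) (sym (strictlyInverseˡ Q)) (Em-self Q)))))
    (subst (length Q ≤_) (length-to P) (Em-one⇒length≤ Q (to P) (Equivalence.to (em P 1) (Em-self P))))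

  occurs-to : ∀ w j → Occurs P w j ⇔ Occurs Q (to w) j
  occurs-to w j with j ≤? length w
  ... | yes j≤ = Em-suc⇔Occurs Q (to w) j (subst (j ≤_) (sym (length-to w)) j≤)
             ⇔-∘ (em w (suc j) ⇔-∘ ⇔-sym (Em-suc⇔Occurs P w j j≤))
  ... | no j≰ rewrite drop-beyond j w j≰
                    | drop-beyond j (to w) (subst (λ n → ¬ j ≤ n) (sym (length-to w)) j≰)
    = mk⇔ (⊑[]-resp-length P Q length-≡) (⊑[]-resp-length Q P (sym length-≡))

one∷⊑-drop : ∀ P j (w : Comp) → Occurs (one ∷ P) w j ⇔ (j < length w × Occurs P w (suc j))
one∷⊑-drop P j       []      rewrite drop-[] {A = ℙ} j = mk⇔ (λ ()) (λ { (() , _) })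
one∷⊑-drop P zero    (x ∷ w) = mk⇔ (λ (_ , d) → s≤s z≤n , d) (λ (_ , d) → val≥1 x , d)
one∷⊑-drop P (suc j) (x ∷ w) = (mk⇔ s≤s s≤s⁻¹ ×-⇔ ⇔-id _) ⇔-∘ one∷⊑-drop P j w

one∷-≈ₛ : ∀ {P Q} → P ≈ₛ Q → (one ∷ P) ≈ₛ (one ∷ Q)
one∷-≈ₛ {P} {Q} s = record
  { length-≡ = cong suc length-≡ ; to = to ; from = from ; to-from = to-from ; from-to = from-to
  ; weight-to = weight-to
  ; occurs-to = λ w j → ⇔-sym (one∷⊑-drop Q j (to w))
                    ⇔-∘ ((mk⇔ (subst (j <_) (sym (length-to w))) (subst (j <_) (length-to w))
                          ×-⇔ occurs-to w (suc j))
                    ⇔-∘ one∷⊑-drop P j w) }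
  where open _≈ₛ_ s

∷ʳ⋢[] : ∀ P {x} → ¬ (P ++ [ x ]) ⊑ []
∷ʳ⋢[] []      ()
∷ʳ⋢[] (_ ∷ _) ()

∷ʳone-⊑-∷ʳ : ∀ P a x → (P ++ [ one ]) ⊑ (a ++ [ x ]) ⇔ P ⊑ a
∷ʳone-⊑-∷ʳ []      []      x = mk⇔ (λ _ → tt) (λ _ → val≥1 x , tt)
∷ʳone-⊑-∷ʳ []      (y ∷ a) x = mk⇔ (λ _ → tt) (λ _ → val≥1 y , tt)
∷ʳone-⊑-∷ʳ (p ∷ P) []      x = mk⇔ (λ (_ , d) → ⊥-elim (∷ʳ⋢[] P d)) (λ ())
∷ʳone-⊑-∷ʳ (p ∷ P) (y ∷ a) x = ⇔-id _ ×-⇔ ∷ʳone-⊑-∷ʳ P a x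

rotate : Comp → Comp
rotate []      = []
rotate (x ∷ t) = t ++ [ x ]

unrotate : Comp → Comp
unrotate w with initLast w
... | []       = []
... | t ∷ʳ′ x = x ∷ t

rotate-unrotate : ∀ w → rotate (unrotate w) ≡ w
rotate-unrotate w with initLast w
... | []       = refl
... | t ∷ʳ′ x = refl

rotate-injective : ∀ a b → rotate a ≡ rotate b → a ≡ b
rotate-injective []      []            _ = refl
rotate-injective []      (_ ∷ [])      ()
rotate-injective []      (_ ∷ _ ∷ _)   ()
rotate-injective (_ ∷ [])    []        ()
rotate-injective (_ ∷ _ ∷ _) []        ()
rotate-injective (x ∷ t) (y ∷ s) e with ∷ʳ-injective t s e
... | t≡s , x≡y = cong₂ _∷_ x≡y t≡s

unrotate-rotate : ∀ w → unrotate (rotate w) ≡ w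
unrotate-rotate w = rotate-injective _ w (rotate-unrotate (rotate w))

rotate-occurs : ∀ P j x x′ t → Occurs (one ∷ P) (x ∷ t) j ⇔ Occurs (P ++ [ one ]) (t ++ [ x′ ]) j
rotate-occurs P zero    x x′ t       = mk⇔ (λ (_ , d) → Equivalence.from (∷ʳone-⊑-∷ʳ P t x′) d)
                                           (λ d → val≥1 x , Equivalence.to (∷ʳone-⊑-∷ʳ P t x′) d)
rotate-occurs P (suc j) x x′ []      rewrite drop-[] {A = ℙ} j = mk⇔ (λ ()) (λ d → ⊥-elim (∷ʳ⋢[] P d))
rotate-occurs P (suc j) x x′ (y ∷ t) = rotate-occurs P j y x′ t

-- 1 is dominated by every letter, so moving it from the front of the pattern to its back
-- is matched by moving the first letter of the text to its end.
one∷≈ₛ∷ʳone : ∀ P → (one ∷ P) ≈ₛ (P ++ [ one ])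
one∷≈ₛ∷ʳone P = record
  { length-≡ = sym (trans (length-++ P) (+-comm (length P) 1))
  ; to = rotate ; from = unrotate ; to-from = rotate-unrotate ; from-to = unrotate-rotate
  ; weight-to = weight-to ; occurs-to = occurs-to }
  where
  weight-to : ∀ w → weight (rotate w) ≡ weight w
  weight-to []      = refl
  weight-to (x ∷ t) = weight-++-comm t [ x ]
  occurs-to : ∀ w j → Occurs (one ∷ P) w j ⇔ Occurs (P ++ [ one ]) (rotate w) j
  occurs-to []      j rewrite drop-[] {A = ℙ} j = mk⇔ (λ ()) (λ d → ⊥-elim (∷ʳ⋢[] P d))
  occurs-to (x ∷ t) j = rotate-occurs P j x x t

module ShiftInvariance (k : ℕ) where

  High : ℙ → Set
  High x = k < val x

  Low : Set
  Low = Σ ℙ λ s → val s ≤ k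

  Runs : Set
  Runs = Comp × List (Low × Comp)

  -- (r₀ , (s₁ , r₁) ∷ ⋯ ∷ (sₙ , rₙ)) stands for r₀⁺ᵏ s₁ r₁⁺ᵏ ⋯ sₙ rₙ⁺ᵏ, the decomposition
  -- of a word into its maximal runs of letters > k.
  join : Comp → List (Low × Comp) → Comp
  join r []               = r ⁺ k
  join r ((s , r′) ∷ rest) = r ⁺ k ++ proj₁ s ∷ join r′ rest

  join-∷ : ∀ a r rest → join (a ∷ r) rest ≡ shift k a ∷ join r rest
  join-∷ a r []      = refl
  join-∷ a r (_ ∷ _) = refl

  unshift : (x : ℙ) → High x → ℙ
  unshift (pos n _) h = pos (n ∸ k) (m<n⇒0<n∸m h)

  shift-unshift : ∀ x h → shift k (unshift x h) ≡ x
  shift-unshift (pos n _) h = ℙ-≡ (m+[n∸m]≡n (<⇒≤ h))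

  unshift-shift : ∀ a h → unshift (shift k a) h ≡ a
  unshift-shift (pos n _) _ = ℙ-≡ (m+n∸m≡n k n)

  shift-high : ∀ a → High (shift k a)
  shift-high a = m<m+n k (val≥1 a)

  ⁺-high : ∀ P → All High (P ⁺ k)
  ⁺-high []      = []
  ⁺-high (p ∷ P) = shift-high p ∷ ⁺-high P

  split : Comp → Runs
  split []      = [] , []
  split (x ∷ w) with k <? val x | split w
  ... | yes h  | r , rest = unshift x h ∷ r , rest
  ... | no  ¬h | r , rest = [] , ((x , ≮⇒≥ ¬h) , r) ∷ rest

  join-split : ∀ w → uncurry join (split w) ≡ w
  join-split []      = refl
  join-split (x ∷ w) with k <? val x | split w | join-split w
  ... | yes h  | r , rest | ih = trans (join-∷ (unshift x h) r rest) (cong₂ _∷_ (shift-unshift x h) ih)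
  ... | no  ¬h | r , rest | ih = cong (x ∷_) ih

  split-join : ∀ r rest → split (join r rest) ≡ (r , rest)
  split-join (a ∷ r) rest rewrite join-∷ a r rest with k <? val (shift k a) | split-join r rest
  ... | yes h  | ih rewrite ih = cong (λ a′ → a′ ∷ r , rest) (unshift-shift a h)
  ... | no  ¬h | _  = ⊥-elim (¬h (shift-high a))
  split-join [] []                        = refl
  split-join [] (((s , s≤k) , r′) ∷ rest) with k <? val s | split-join r′ rest
  ... | yes h  | _  = ⊥-elim (<⇒≱ h s≤k)
  ... | no  ¬h | ih rewrite ih = cong (λ q → [] , ((s , q) , r′) ∷ rest) (≤-irrelevant _ _)

  mapRuns : (Comp → Comp) → Runs → Runs
  mapRuns f (r , rest) = f r , map (map₂ f) rest

  mapRuns-inverse : ∀ {f g} → (∀ w → g (f w) ≡ w) → ∀ b → mapRuns g (mapRuns f b) ≡ b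
  mapRuns-inverse gf (r , rest) = cong₂ _,_ (gf r)
    (trans (sym (map-∘ rest)) (trans (map-cong (λ (s , r′) → cong (s ,_) (gf r′)) rest) (map-id rest)))

  onRuns : (Comp → Comp) → Comp → Comp
  onRuns f w = uncurry join (mapRuns f (split w))

  onRuns-inverse : ∀ {f g} → (∀ w → g (f w) ≡ w) → ∀ w → onRuns g (onRuns f w) ≡ w
  onRuns-inverse {f} {g} gf w = begin
    uncurry join (mapRuns g (split (uncurry join (mapRuns f (split w)))))
      ≡⟨ cong (uncurry join ∘ mapRuns g) (uncurry split-join (mapRuns f (split w))) ⟩
    uncurry join (mapRuns g (mapRuns f (split w)))
      ≡⟨ cong (uncurry join) (mapRuns-inverse gf (split w)) ⟩
    uncurry join (split w)
      ≡⟨ join-split w ⟩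
    w ∎
    where open ≡-Reasoning

  weight-join : ∀ f → (∀ w → weight (f w) ≡ weight w) →
                ∀ r rest → weight (uncurry join (mapRuns f (r , rest))) ≡ weight (join r rest)
  weight-join f wf r []               = weight-⁺-cong k (f r) r (wf r)
  weight-join f wf r ((s , r′) ∷ rest) =
    weight-++-cong (f r ⁺ k) (r ⁺ k) _ _ (weight-⁺-cong k (f r) r (wf r))
                   (weight-∷-cong (proj₁ s) (join (f r′) (map (map₂ f) rest)) (join r′ rest) (weight-join f wf r′ rest))

  ⊑-⁺ : ∀ P t → (P ⁺ k) ⊑ (t ⁺ k) ⇔ P ⊑ t
  ⊑-⁺ []            _             = mk⇔ (λ _ → tt) (λ _ → tt)
  ⊑-⁺ (_ ∷ _)       []            = mk⇔ (λ ()) (λ ())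
  ⊑-⁺ (pos a _ ∷ P) (pos b _ ∷ t) = mk⇔ (+-cancelˡ-≤ k a b) (+-monoʳ-≤ k) ×-⇔ ⊑-⁺ P t

  occurs-⁺ : ∀ P r j → Occurs (P ⁺ k) (r ⁺ k) j ⇔ Occurs P r j
  occurs-⁺ P r j rewrite drop-map {f = shift k} j r = ⊑-⁺ P (drop j r)

  -- A pattern of letters > k never straddles a letter ≤ k, so it occurs within a single run.
  ⊑-++-low : ∀ {P} → All High P → (s : Low) → ∀ a b → P ⊑ (a ++ proj₁ s ∷ b) ⇔ P ⊑ a
  ⊑-++-low []       _         _       _ = mk⇔ (λ _ → tt) (λ _ → tt)
  ⊑-++-low (h ∷ _)  (_ , s≤k) []      _ = mk⇔ (λ (p≤s , _) → ⊥-elim (<⇒≱ h (≤-trans p≤s s≤k))) (λ ())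
  ⊑-++-low (_ ∷ hs) s         (_ ∷ a) b = ⇔-id _ ×-⇔ ⊑-++-low hs s a b

  module _ {P Q} (s : P ≈ₛ Q) where
    open _≈ₛ_ s

    occurs-run : ∀ r j → Occurs (P ⁺ k) (r ⁺ k) j ⇔ Occurs (Q ⁺ k) (to r ⁺ k) j
    occurs-run r j = ⇔-sym (occurs-⁺ Q (to r) j) ⇔-∘ (occurs-to r j ⇔-∘ occurs-⁺ P r j)

    length-run : ∀ r → length (to r ⁺ k) ≡ length (r ⁺ k)
    length-run r = trans (length-map (shift k) (to r)) (trans (length-to r) (sym (length-map (shift k) r)))

    occurs-join : ∀ r rest j → Occurs (P ⁺ k) (join r rest) j ⇔ Occurs (Q ⁺ k) (uncurry join (mapRuns to (r , rest))) j
    occurs-join r []               j = occurs-run r j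
    occurs-join r ((x , r′) ∷ rest) j with j ≤? length (r ⁺ k)
    ... | yes j≤ rewrite drop-++-≤ j (r ⁺ k) (proj₁ x ∷ join r′ rest) j≤
                       | drop-++-≤ j (to r ⁺ k) (proj₁ x ∷ uncurry join (mapRuns to (r′ , rest)))
                                   (subst (j ≤_) (sym (length-run r)) j≤)
      = ⇔-sym (⊑-++-low (⁺-high Q) x _ _) ⇔-∘ (occurs-run r j ⇔-∘ ⊑-++-low (⁺-high P) x _ _)
    ... | no j≰ rewrite drop-++-∷ j (r ⁺ k) (proj₁ x) (join r′ rest) (≰⇒> j≰)
                      | drop-++-∷ j (to r ⁺ k) (proj₁ x) (uncurry join (mapRuns to (r′ , rest)))
                                  (subst (_< j) (sym (length-run r)) (≰⇒> j≰))
                      | length-run r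
      = occurs-join r′ rest (j ∸ suc (length (r ⁺ k)))

  ⁺-≈ₛ : ∀ {P Q} → P ≈ₛ Q → (P ⁺ k) ≈ₛ (Q ⁺ k)
  ⁺-≈ₛ {P} {Q} s = record
    { length-≡ = trans (length-map (shift k) P) (trans length-≡ (sym (length-map (shift k) Q)))
    ; to = onRuns to ; from = onRuns from
    ; to-from = onRuns-inverse to-from ; from-to = onRuns-inverse from-to
    ; weight-to = λ w → trans (uncurry (weight-join to weight-to) (split w)) (cong weight (join-split w))
    ; occurs-to = λ w j → subst (λ w′ → Occurs (P ⁺ k) w′ j ⇔ Occurs (Q ⁺ k) (onRuns to w) j)
                                (join-split w) (uncurry (occurs-join s) (split w) j) }
    where open _≈ₛ_ s

head-least : ∀ a y → WeaklyIncreasing (a ∷ y) → All (a ≤ₚ_) (a ∷ y)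
head-least a y = Linked⇒All {R = _≤ₚ_} (λ {i j k} → ≤-trans {val i} {val j} {val k}) {v = a} ≤-refl

leading-one-or-large : ∀ y → WeaklyIncreasing y → (Σ Comp λ y₁ → y ≡ one ∷ y₁) ⊎ All Large y
leading-one-or-large []      _  = inj₂ []
leading-one-or-large (a ∷ y) wy with val a ≤? 1
... | yes a≤1 = inj₁ (y , cong (_∷ y) (≤1⇒≡one a a≤1))
... | no  a≰1 = inj₂ (All.map (λ {b} → ≤ₚ-large {a} {b} (≰⇒> a≰1)) (head-least a y wy))

Linked-init : ∀ {R : ℙ → ℙ → Set} xs {x} → Linked R (xs ∷ʳ x) → Linked R xs
Linked-init []          _         = []
Linked-init (_ ∷ [])    _         = [-]
Linked-init (_ ∷ _ ∷ _) (r ∷ rxs) = r ∷ Linked-init (_ ∷ _) rxs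

last-least : ∀ xs {x} → WeaklyDecreasing (xs ∷ʳ x) → All (x ≤ₚ_) (xs ∷ʳ x)
last-least []          _         = ≤-refl ∷ []
last-least (_ ∷ xs) {x} wd with last-least xs {x} (Linked.tail wd)
last-least (_ ∷ []) wd | l = Linked.head wd ∷ l
last-least (_ ∷ _ ∷ _) wd | l@(x≤y ∷ _) = ≤-trans x≤y (Linked.head wd) ∷ l

trailing-one-or-large : ∀ z → WeaklyDecreasing z → (Σ Comp λ z₁ → z ≡ z₁ ∷ʳ one) ⊎ All Large z
trailing-one-or-large z wz with initLast z
... | []       = inj₂ []
... | z₁ ∷ʳ′ b with val b ≤? 1
...   | yes b≤1 = inj₁ (z₁ , cong (z₁ ∷ʳ_) (≤1⇒≡one b b≤1))
...   | no  b≰1 = inj₂ (All.map (λ {x} → ≤ₚ-large {b} {x} (≰⇒> b≰1)) (last-least z₁ wz))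

record OneRemoved (y z : Comp) : Set where
  field
    y₁ z₁   : Comp
    y₁-inc  : WeaklyIncreasing y₁
    z₁-dec  : WeaklyDecreasing z₁
    perm    : (y ++ z) ↭ (one ∷ y₁ ++ z₁)
    ≈ₛ-one∷ : ∀ U → (y ++ U ++ z) ≈ₛ (one ∷ y₁ ++ U ++ z₁)

remove-one-or-large : ∀ y z → WeaklyIncreasing y → WeaklyDecreasing z →
                      OneRemoved y z ⊎ All Large (y ++ z)
remove-one-or-large y z wy wz with leading-one-or-large y wy
... | inj₁ (y₁ , refl) = inj₁ record
  { y₁ = y₁ ; z₁ = z ; y₁-inc = Linked.tail wy ; z₁-dec = wz ; perm = ↭-refl ; ≈ₛ-one∷ = λ _ → ≈ₛ-refl }
... | inj₂ y-large with trailing-one-or-large z wz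
...   | inj₂ z-large      = inj₂ (++⁺ y-large z-large)
...   | inj₁ (z₁ , refl) = inj₁ record
  { y₁ = y ; z₁ = z₁ ; y₁-inc = wy ; z₁-dec = Linked-init z₁ wz
  ; perm = ↭-trans (↭-reflexive (sym (++-assoc y z₁ [ one ]))) (↭-sym (∷↭∷ʳ one (y ++ z₁)))
  ; ≈ₛ-one∷ = λ U → subst (_≈ₛ (one ∷ y ++ U ++ z₁)) (assoc U) (≈ₛ-sym (one∷≈ₛ∷ʳone (y ++ U ++ z₁))) }
  where
  assoc : ∀ U → (y ++ U ++ z₁) ++ [ one ] ≡ y ++ U ++ z₁ ∷ʳ one
  assoc U = trans (++-assoc y (U ++ z₁) [ one ]) (cong (y ++_) (++-assoc U z₁ [ one ]))

one-removed-not-large : ∀ {y z} → OneRemoved y z → ¬ All Large (y ++ z)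
one-removed-not-large r large with All-resp-↭ (OneRemoved.perm r) large
... | two≤one ∷ _ = one-not-large two≤one

-- Lowers letters ≥ 2 by one; it is only ever applied to such letters.
pred₁ : ℙ → ℙ
pred₁ (pos (suc (suc n)) _) = pos (suc n) (s≤s z≤n)
pred₁ x                     = x

shift-pred₁ : ∀ x → Large x → shift 1 (pred₁ x) ≡ x
shift-pred₁ (pos (suc (suc n)) _) _ = ℙ-≡ refl
shift-pred₁ (pos (suc zero) _) (s≤s ())

pred₁-⁺1 : ∀ w → All Large w → map pred₁ w ⁺ 1 ≡ w
pred₁-⁺1 w large = trans (sym (map-∘ w)) (map-id-local (All.map (λ {x} → shift-pred₁ x) large))

⁺-reflects-increasing : ∀ k w → WeaklyIncreasing (w ⁺ k) → WeaklyIncreasing w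
⁺-reflects-increasing k w = Linked.map (λ {a b} → +-cancelˡ-≤ k (val a) (val b)) ∘ Linked.map⁻

⁺-reflects-decreasing : ∀ k w → WeaklyDecreasing (w ⁺ k) → WeaklyDecreasing w
⁺-reflects-decreasing k w = Linked.map (λ {a b} → +-cancelˡ-≤ k (val b) (val a)) ∘ Linked.map⁻

lower-increasing : ∀ y → All Large y → WeaklyIncreasing y → WeaklyIncreasing (map pred₁ y)
lower-increasing y large wy =
  ⁺-reflects-increasing 1 (map pred₁ y) (subst WeaklyIncreasing (sym (pred₁-⁺1 y large)) wy)

lower-decreasing : ∀ z → All Large z → WeaklyDecreasing z → WeaklyDecreasing (map pred₁ z)
lower-decreasing z large wz =
  ⁺-reflects-decreasing 1 (map pred₁ z) (subst WeaklyDecreasing (sym (pred₁-⁺1 z large)) wz)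

lower-bound : ∀ k w → All Large w → All (λ x → val x ≤ suc k) w → All (λ x → val x ≤ k) (map pred₁ w)
lower-bound k w large bound =
  All.map s≤s⁻¹ (All.map⁻ (subst (All (λ x → val x ≤ suc k)) (sym (pred₁-⁺1 w large)) bound))

raise-lowered : ∀ m y z U → All Large (y ++ z) →
                (map pred₁ y ++ U ⁺ m ++ map pred₁ z) ⁺ 1 ≡ y ++ U ⁺ suc m ++ z
raise-lowered m y z U large = begin
  (map pred₁ y ++ U ⁺ m ++ map pred₁ z) ⁺ 1
    ≡⟨ map-++ (shift 1) (map pred₁ y) _ ⟩
  map pred₁ y ⁺ 1 ++ (U ⁺ m ++ map pred₁ z) ⁺ 1
    ≡⟨ cong (map pred₁ y ⁺ 1 ++_) (map-++ (shift 1) (U ⁺ m) _) ⟩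
  map pred₁ y ⁺ 1 ++ (U ⁺ m) ⁺ 1 ++ map pred₁ z ⁺ 1
    ≡⟨ cong₂ _++_ (pred₁-⁺1 y (++⁻ˡ y large)) (cong₂ _++_ (⁺-⁺ U 1 m) (pred₁-⁺1 z (++⁻ʳ y large))) ⟩
  y ++ U ⁺ suc m ++ z ∎
  where open ≡-Reasoning

length-map-++ : ∀ (f : ℙ → ℙ) y z → length (map f y ++ map f z) ≡ length (y ++ z)
length-map-++ f y z = trans (cong length (sym (map-++ f y z))) (length-map f (y ++ z))

no-letter : ∀ w → All Large w → All (λ x → val x ≤ 1) w → w ≡ []
no-letter []      _             _           = refl
no-letter (_ ∷ _) (large ∷ _) (small ∷ _) = ⊥-elim (<⇒≱ large small)

record Admissible (m : ℕ) (y y′ z z′ : Comp) : Set where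
  field
    y-inc  : WeaklyIncreasing y
    y′-inc : WeaklyIncreasing y′
    z-dec  : WeaklyDecreasing z
    z′-dec : WeaklyDecreasing z′
    perm   : (y ++ z) ↭ (y′ ++ z′)
    bound  : All (λ x → val x ≤ m + 1) (y ++ z)

peel-admissible : ∀ {m y y′ z z′} → Admissible m y y′ z z′ → (r : OneRemoved y z) (r′ : OneRemoved y′ z′) →
                  Admissible m (OneRemoved.y₁ r) (OneRemoved.y₁ r′) (OneRemoved.z₁ r) (OneRemoved.z₁ r′)
peel-admissible a r r′ = record
  { y-inc = R.y₁-inc ; y′-inc = R′.y₁-inc ; z-dec = R.z₁-dec ; z′-dec = R′.z₁-dec
  ; perm = drop-∷ (↭-trans (↭-sym R.perm) (↭-trans perm R′.perm))
  ; bound = All.tail (All-resp-↭ R.perm bound) }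
  where open Admissible a; module R = OneRemoved r; module R′ = OneRemoved r′

lower-admissible : ∀ {m y y′ z z′} → Admissible (suc m) y y′ z z′ →
                   All Large (y ++ z) → All Large (y′ ++ z′) →
                   Admissible m (map pred₁ y) (map pred₁ y′) (map pred₁ z) (map pred₁ z′)
lower-admissible {m} {y} {y′} {z} {z′} a large large′ = record
  { y-inc  = lower-increasing y (++⁻ˡ y large) y-inc
  ; y′-inc = lower-increasing y′ (++⁻ˡ y′ large′) y′-inc
  ; z-dec  = lower-decreasing z (++⁻ʳ y large) z-dec
  ; z′-dec = lower-decreasing z′ (++⁻ʳ y′ large′) z′-dec
  ; perm   = subst₂ _↭_ (map-++ pred₁ y z) (map-++ pred₁ y′ z′) (↭.map⁺ pred₁ perm)
  ; bound  = subst (All _) (map-++ pred₁ y z) (lower-bound (m + 1) (y ++ z) large bound) }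
  where open Admissible a

empty-context : ∀ {u v} m y y′ z z′ → u ≈ₛ v → zero ≡ length (y ++ z) → (y ++ z) ↭ (y′ ++ z′) →
                (y ++ u ⁺ m ++ z) ≈ₛ (y′ ++ v ⁺ m ++ z′)
empty-context m [] []       [] []       s _  _ =
  subst₂ _≈ₛ_ (sym (++-identityʳ _)) (sym (++-identityʳ _)) (ShiftInvariance.⁺-≈ₛ m s)
empty-context m [] (_ ∷ _)  [] _        _ _  p = ⊥-elim (¬x∷xs↭[] (↭-sym p))
empty-context m [] []       [] (_ ∷ _)  _ _  p = ⊥-elim (¬x∷xs↭[] (↭-sym p))
empty-context m [] _        (_ ∷ _) _   _ () _
empty-context m (_ ∷ _) _   _ _         _ () _

module _ {u v} (u≈v : u ≈ₛ v) where

  -- Recursion is lexicographic in (m , n): removing a 1 shortens y ++ z, lowering decreases m.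
  context-≈ₛ : ∀ m n {y y′ z z′} → Admissible m y y′ z z′ → n ≡ length (y ++ z) →
               (y ++ u ⁺ m ++ z) ≈ₛ (y′ ++ v ⁺ m ++ z′)
  context-≈ₛ m zero {y} {y′} {z} {z′} a len = empty-context m y y′ z z′ u≈v len (Admissible.perm a)
  context-≈ₛ m (suc n) {y} {y′} {z} {z′} a len
    with remove-one-or-large y z (Admissible.y-inc a) (Admissible.z-dec a)
       | remove-one-or-large y′ z′ (Admissible.y′-inc a) (Admissible.z′-dec a)
  ... | inj₁ r | inj₁ r′ =
    ≈ₛ-trans (OneRemoved.≈ₛ-one∷ r (u ⁺ m))
      (≈ₛ-trans (one∷-≈ₛ (context-≈ₛ m n (peel-admissible a r r′)
                            (suc-injective (trans len (↭-length (OneRemoved.perm r))))))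
                (≈ₛ-sym (OneRemoved.≈ₛ-one∷ r′ (v ⁺ m))))
  ... | inj₁ r | inj₂ large′ = ⊥-elim (one-removed-not-large r (All-resp-↭ (↭-sym (Admissible.perm a)) large′))
  ... | inj₂ large | inj₁ r′ = ⊥-elim (one-removed-not-large r′ (All-resp-↭ (Admissible.perm a) large))
  context-≈ₛ zero (suc n) {y} {y′} {z} {z′} a len | inj₂ large | inj₂ _ =
    empty-context zero y y′ z z′ u≈v (sym (cong length (no-letter _ large (Admissible.bound a)))) (Admissible.perm a)
  context-≈ₛ (suc m) (suc n) {y} {y′} {z} {z′} a len | inj₂ large | inj₂ large′ =
    subst₂ _≈ₛ_ (raise-lowered m y z u large) (raise-lowered m y′ z′ v large′)
      (ShiftInvariance.⁺-≈ₛ 1 (context-≈ₛ m (suc n) (lower-admissible a large large′)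
                                 (trans len (sym (length-map-++ pred₁ y z)))))

maxLetter≤⇒All : ∀ w {k} → maxLetter w ≤ k → All (λ x → val x ≤ k) w
maxLetter≤⇒All []      _ = []
maxLetter≤⇒All (x ∷ w) l = m⊔n≤o⇒m≤o (val x) _ l ∷ maxLetter≤⇒All w (m⊔n≤o⇒n≤o (val x) _ l)

corollary5p2 : (y y′ z z′ : Comp) → WeaklyIncreasing y → WeaklyIncreasing y′ →
                 WeaklyDecreasing z → WeaklyDecreasing z′ → (y ++ z) ↭ (y′ ++ z′) →
                 (u v : Comp) → u ∼ₛ v → (m : ℕ) → maxLetter (y ++ z) ≤ m + 1 →
                 (y ++ (u ⁺ m) ++ z) ∼ₛ (y′ ++ (v ⁺ m) ++ z′)
corollary5p2 y y′ z z′ wy wy′ wz wz′ p u v u∼v m max≤ =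
  ≈ₛ⇒∼ₛ (context-≈ₛ (∼ₛ⇒≈ₛ u∼v) m _ admissible refl)
  where
  admissible : Admissible m y y′ z z′
  admissible = record
    { y-inc = wy ; y′-inc = wy′ ; z-dec = wz ; z′-dec = wz′ ; perm = p
    ; bound = maxLetter≤⇒All (y ++ z) max≤ }
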